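{- If $G$ is a connected graph, $v\in V(G)$ and $e\in E(G)$, then $\mathrm{cat}(G,v)\geq \mathrm{cat}(G-e,v)$.
   Context: Cat Herding is a two-player game on a finite simple graph $G$ between a cat and a herder. First the cat places its token on a starting vertex. Then the players alternate, the herder moving first: on the herder's turn it deletes one edge of the current graph (a "cut"); on the cat's turn the cat must move its token along a path of the current graph to a different vertex. The game ends when the cat's current vertex has no incident edges. The score is the total number of edges deleted; the herder minimizes and the cat maximizes it. For $v\in V(G)$, $\mathrm{cat}(G,v)$ is the optimal-play score when the cat starts at $v$ (for a possibly disconnected graph the game is played on the whole graph in the same way). $G-e$ is $G$ with the edge $e$ deleted. -}

module Defs where

open import Data.Bool using (Bool; true; false; _∧_; _∨_; not; if_then_else_; T)
open import Data.Bool.Properties using (∧-comm; ∨-comm)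
open import Data.Nat using (ℕ; zero; suc; _⊔_; _⊓_; _*_; _≤_)
open import Data.Fin using (Fin; _≟_)
open import Data.List using (List; []; _∷_; [_]; map; foldr; concatMap; allFin)
open import Data.Bool.ListAction using (any)
open import Data.Product using (_×_; _,_)
open import Relation.Nullary.Decidable using (⌊_⌋)
open import Relation.Binary.PropositionalEquality using (_≡_; refl; cong₂)
open import Relation.Binary.Construct.Closure.ReflexiveTransitive using (Star)

Adjacency : ℕ → Set
Adjacency n = Fin n → Fin n → Bool

record SimpleGraph (n : ℕ) : Set where
  field
    adj    : Adjacency n
    sym    : ∀ u w → adj u w ≡ adj w u
    irrefl : ∀ u → adj u u ≡ false
open SimpleGraph public

module _ {n : ℕ} where

  _==_ : Fin n → Fin n → Bool
  a == b = ⌊ a ≟ b ⌋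

  deleteAdj : Adjacency n → Fin n → Fin n → Adjacency n
  deleteAdj A a b x y = A x y ∧ not ((x == a ∧ y == b) ∨ (x == b ∧ y == a))

  Adj : SimpleGraph n → Fin n → Fin n → Set
  Adj G u w = T (adj G u w)

  Connected : SimpleGraph n → Set
  Connected G = ∀ u w → Star (Adj G) u w

  isolated : Adjacency n → Fin n → Bool
  isolated A v = not (any (A v) (allFin n))

  reachWithin : Adjacency n → ℕ → Fin n → Fin n → Bool
  reachWithin A zero    v w = v == w
  reachWithin A (suc k) v w =
    reachWithin A k v w ∨ any (λ u → reachWithin A k v u ∧ A u w) (allFin n)

  -- w is reachable from v (a walk of length ≤ n suffices on n vertices)
  reachable : Adjacency n → Fin n → Fin n → Bool
  reachable A v w = reachWithin A n v w

  -- edges as ordered pairs (both orientations listed)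
  edgesOf : Adjacency n → List (Fin n × Fin n)
  edgesOf A = concatMap (λ a → concatMap (λ b → if A a b then [ (a , b) ] else []) (allFin n)) (allFin n)

  catTargets : Adjacency n → Fin n → List (Fin n)
  catTargets A v = concatMap (λ w → if reachable A v w ∧ not (w == v) then [ w ] else []) (allFin n)

  minList : List ℕ → ℕ
  minList []       = 0
  minList (x ∷ xs) = foldr _⊓_ x xs

  maxList : List ℕ → ℕ
  maxList = foldr _⊔_ 0

  -- Optimal remaining score with the herder to move (cat at v, graph A),
  -- and with the cat to move.  The first argument is fuel; it is
  -- sufficient once it is at least the number of edges.
  mutual
    herderTurn : ℕ → Adjacency n → Fin n → ℕ
    herderTurn zero    A v = 0
    herderTurn (suc f) A v =
      if isolated A v then 0
      else minList (map (λ { (a , b) → suc (catTurn f (deleteAdj A a b) v) }) (edgesOf A))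

    catTurn : ℕ → Adjacency n → Fin n → ℕ
    catTurn f A v =
      if isolated A v then 0
      else maxList (map (herderTurn f A) (catTargets A v))

  -- cat(G, v): the cat starts at v, the herder moves first.
  -- Fuel n * n bounds the number of edges of a simple graph on n vertices.
  cat : SimpleGraph n → Fin n → ℕ
  cat G v = herderTurn (n * n) (adj G) v

  private
    match-sym : ∀ a b x y →
      ((y == a ∧ x == b) ∨ (y == b ∧ x == a)) ≡ ((x == a ∧ y == b) ∨ (x == b ∧ y == a))
    match-sym a b x y
      rewrite ∧-comm (y == a) (x == b) | ∧-comm (y == b) (x == a)
      = ∨-comm (x == b ∧ y == a) (x == a ∧ y == b)

  deleteEdge : (G : SimpleGraph n) → Fin n → Fin n → SimpleGraph n
  deleteEdge G a b = record
    { adj    = deleteAdj (adj G) a b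
    ; sym    = λ u w → cong₂ (λ p q → p ∧ not q) (sym G u w) (match-sym a b w u)
    ; irrefl = λ u → cong₂ _∧_ (irrefl G u) refl
    }

{-# OPTIONS --safe #-}
-- For fixed fuel both game values are monotone in the edge set: if B ⊆ A then
-- the herder on B does at least as well as on A.  When the herder on A cuts xy,
-- the herder on B cuts the same edge if it is still there and an arbitrary edge
-- at the cat otherwise; either way the new position on B is a subgraph of A - xy.
-- The cat's moves on B are available on A because reachability is monotone, so
-- induction on the fuel goes through.
module Submission where

open import Defs
open import Data.Nat using (ℕ; _≥_)
open import Data.Fin using (Fin)
open import Data.Bool using (true)
open import Relation.Binary.PropositionalEquality using (_≡_)

open import Data.Bool using (Bool; false; T; _∧_; _∨_; not; if_then_else_)
open import Data.Bool.ListAction using (any)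
open import Data.Bool.Properties using (T?; T-∧; T-∨; T-≡; ∨-comm)
open import Data.Nat using (zero; suc; _≤_; z≤n; s≤s; _*_)
open import Data.Nat.Properties
  using (≤-reflexive; ≤-trans; ⊔-lub; ⊓-glb; m≤n⇒m≤n⊔o; m≤n⇒m≤o⊔n; m≤n⇒m⊓o≤n; m≤n⇒o⊓m≤n)
open import Data.List using ([]; _∷_; [_]; map; allFin)
open import Data.List.Properties using (foldr-preservesᵇ; foldr-preservesᵒ)
open import Data.List.Relation.Unary.All using (All; _∷_; tabulate)
open import Data.List.Relation.Unary.All.Properties using (map⁺)
open import Data.List.Relation.Unary.Any as Any using (Any; here; there; satisfied)
open import Data.List.Relation.Unary.Any.Properties using (any⁺; any⁻)
open import Data.List.Membership.Propositional using (_∈_; lose)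
open import Data.List.Membership.Propositional.Properties
  using (∈-concatMap⁺; ∈-concatMap⁻; ∈-allFin; ∈-map⁺)
open import Data.List.Relation.Binary.Subset.Propositional using (_⊆_)
open import Data.Product using (_×_; _,_; ∃-syntax; proj₁)
import Data.Product as Product
open import Data.Sum using (_⊎_; inj₁; inj₂)
import Data.Sum as Sum
open import Function using (_∘_; id; Equivalence)
open import Relation.Nullary using (¬_; yes; no)
open import Relation.Nullary.Decidable using (toWitness)
open import Relation.Binary.PropositionalEquality
  using (refl; cong; subst) renaming (sym to ≡-sym)

open Equivalence using (to; from)

∧-monoᵀ : ∀ {a b a′ b′} → (T a → T a′) → (T b → T b′) → T (a ∧ b) → T (a′ ∧ b′)
∧-monoᵀ f g = from T-∧ ∘ Product.map f g ∘ to T-∧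

∨-monoᵀ : ∀ {a b a′ b′} → (T a → T a′) → (T b → T b′) → T (a ∨ b) → T (a′ ∨ b′)
∨-monoᵀ f g = from T-∨ ∘ Sum.map f g ∘ to T-∨

any-monoᵀ : ∀ {A : Set} {p q : A → Bool} xs → (∀ {x} → T (p x) → T (q x)) →
            T (any p xs) → T (any q xs)
any-monoᵀ {p = p} {q} xs f = any⁺ q ∘ Any.map f ∘ any⁻ p xs

¬T⇒T-not : ∀ {b} → ¬ T b → T (not b)
¬T⇒T-not {false} _  = _
¬T⇒T-not {true}  ¬t with () ← ¬t _

∈-if⁺ : ∀ {A : Set} {c} {x : A} → T c → x ∈ (if c then [ x ] else [])
∈-if⁺ {c = true} _ = here refl

∈-if⁻ : ∀ {A : Set} {c} {x y : A} → y ∈ (if c then [ x ] else []) → T c × y ≡ x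
∈-if⁻ {c = true} (here y≡x) = _ , y≡x

module _ {n : ℕ} where

  ≤-maxList : ∀ {y xs} → y ∈ xs → y ≤ maxList {n} xs
  ≤-maxList {xs = xs} y∈xs =
    foldr-preservesᵒ (λ a b → Sum.[ m≤n⇒m≤n⊔o b , m≤n⇒m≤o⊔n a ]) 0 xs
                     (inj₂ (Any.map ≤-reflexive y∈xs))

  maxList-≤ : ∀ {m xs} → All (_≤ m) xs → maxList {n} xs ≤ m
  maxList-≤ = foldr-preservesᵇ ⊔-lub z≤n

  minList-≤ : ∀ {y xs} → y ∈ xs → minList {n} xs ≤ y
  minList-≤ {xs = x ∷ xs} y∈x∷xs =
    foldr-preservesᵒ (λ a b → Sum.[ m≤n⇒m⊓o≤n b , m≤n⇒o⊓m≤n a ]) x xs (head-or-tail y∈x∷xs)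
    where
    head-or-tail : ∀ {y} → y ∈ x ∷ xs → x ≤ y ⊎ Any (_≤ y) xs
    head-or-tail (here y≡x)  = inj₁ (≤-reflexive (≡-sym y≡x))
    head-or-tail (there y∈xs) = inj₂ (Any.map (≤-reflexive ∘ ≡-sym) y∈xs)

  -- The membership only excludes xs = [], where minList is 0.
  ≤-minList : ∀ {m y xs} → y ∈ xs → All (m ≤_) xs → m ≤ minList {n} xs
  ≤-minList _ (m≤x ∷ m≤xs) = foldr-preservesᵇ ⊓-glb m≤x m≤xs

  private variable
    A B : Adjacency n
    a b u v w x y : Fin n

  infix 4 _⊆ᴱ_

  -- A record rather than a Π-type, so that B and A are inferable from a proof.
  record _⊆ᴱ_ (B A : Adjacency n) : Set where
    constructor edges⊆
    field edge : ∀ {x y} → T (B x y) → T (A x y)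
  open _⊆ᴱ_

  ⊆ᴱ-trans : ∀ {C} → C ⊆ᴱ B → B ⊆ᴱ A → C ⊆ᴱ A
  ⊆ᴱ-trans C⊆B B⊆A = edges⊆ (B⊆A .edge ∘ C⊆B .edge)

  deleteAdj-⊆ᴱ : ∀ a b → deleteAdj A a b ⊆ᴱ A
  deleteAdj-⊆ᴱ a b = edges⊆ (proj₁ ∘ to T-∧)

  deleteAdj-mono : ∀ a b → B ⊆ᴱ A → deleteAdj B a b ⊆ᴱ deleteAdj A a b
  deleteAdj-mono a b B⊆A = edges⊆ (∧-monoᵀ (B⊆A .edge) id)

  deleteAdj-swap : ∀ a b → deleteAdj A a b ⊆ᴱ deleteAdj A b a
  deleteAdj-swap {A = A} a b = edges⊆ λ {x} {y} →
    subst T (cong (λ m → A x y ∧ not m) (∨-comm (x == a ∧ y == b) (x == b ∧ y == a)))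

  deleted-edge : T ((x == a ∧ y == b) ∨ (x == b ∧ y == a)) →
                 (x ≡ a × y ≡ b) ⊎ (x ≡ b × y ≡ a)
  deleted-edge {x = x} {a = a} {y = y} {b = b} m with to T-∨ m
  ... | inj₁ ab = inj₁ (Product.map toWitness toWitness (to (T-∧ {x == a}) ab))
  ... | inj₂ ba = inj₂ (Product.map toWitness toWitness (to (T-∧ {x == b}) ba))

  ⊆ᴱ-deleteAdj : ∀ a b → B ⊆ᴱ A → ¬ T (B a b) → ¬ T (B b a) → B ⊆ᴱ deleteAdj A a b
  ⊆ᴱ-deleteAdj {B = B} a b B⊆A ¬Bab ¬Bba = edges⊆ λ Bxy →
    from T-∧ (B⊆A .edge Bxy , ¬T⇒T-not (not-ab Bxy ∘ deleted-edge))
    where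
    not-ab : ∀ {x y} → T (B x y) → ¬ ((x ≡ a × y ≡ b) ⊎ (x ≡ b × y ≡ a))
    not-ab Bab (inj₁ (refl , refl)) = ¬Bab Bab
    not-ab Bba (inj₂ (refl , refl)) = ¬Bba Bba

  neighbour⇒¬isolated : T (A v u) → isolated A v ≡ false
  neighbour⇒¬isolated {A = A} {v = v} {u = u} Avu =
    cong not (to T-≡ (any⁺ (A v) (lose (∈-allFin u) Avu)))

  isolated-or-neighbour : ∀ A v → isolated A v ≡ true ⊎ ∃[ u ] T (A v u)
  isolated-or-neighbour A v with any (A v) (allFin n) in e
  ... | false = inj₁ refl
  ... | true  = inj₂ (satisfied (any⁻ (A v) (allFin n) (from T-≡ e)))

  reachWithin-mono : B ⊆ᴱ A → ∀ k →
                     T (reachWithin B k v w) → T (reachWithin A k v w)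
  reachWithin-mono B⊆A zero    = id
  reachWithin-mono B⊆A (suc k) =
    ∨-monoᵀ (reachWithin-mono B⊆A k)
            (any-monoᵀ (allFin n) (∧-monoᵀ (reachWithin-mono B⊆A k) (B⊆A .edge)))

  ∈-edgesOf⁺ : T (A x y) → (x , y) ∈ edgesOf A
  ∈-edgesOf⁺ {x = x} {y = y} Axy =
    ∈-concatMap⁺ _ (lose (∈-allFin x) (∈-concatMap⁺ _ (lose (∈-allFin y) (∈-if⁺ Axy))))

  ∈-catTargets⁺ : T (reachable A v w ∧ not (w == v)) → w ∈ catTargets A v
  ∈-catTargets⁺ {w = w} t = ∈-concatMap⁺ _ (lose (∈-allFin w) (∈-if⁺ t))

  ∈-catTargets⁻ : w ∈ catTargets A v → T (reachable A v w ∧ not (w == v))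
  ∈-catTargets⁻ w∈ with satisfied (∈-concatMap⁻ _ {xs = allFin n} w∈)
  ... | _ , w∈singleton with ∈-if⁻ w∈singleton
  ...   | t , refl = t

  catTargets-mono : B ⊆ᴱ A → ∀ v → catTargets B v ⊆ catTargets A v
  catTargets-mono B⊆A v = ∈-catTargets⁺ ∘ ∧-monoᵀ (reachWithin-mono B⊆A n) id ∘ ∈-catTargets⁻

  herderTurn-isolated : ∀ f → isolated A v ≡ true → herderTurn f A v ≡ 0
  herderTurn-isolated zero    _ = refl
  herderTurn-isolated (suc f) isolated-v rewrite isolated-v = refl

  herderTurn-mono : ∀ f → B ⊆ᴱ A → ∀ v → herderTurn f B v ≤ herderTurn f A v
  catTurn-mono : ∀ f → B ⊆ᴱ A → ∀ v → catTurn f B v ≤ catTurn f A v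

  herderTurn-≤-cut : ∀ f → T (A x y) →
                     herderTurn (suc f) A v ≤ suc (catTurn f (deleteAdj A x y) v)
  herderTurn-≤-cut {A = A} {v = v} f Axy with isolated A v
  ... | true  = z≤n
  ... | false = minList-≤ (∈-map⁺ _ (∈-edgesOf⁺ Axy))

  herderTurn-≤-suc-catTurn : ∀ f v → herderTurn (suc f) A v ≤ suc (catTurn f A v)
  herderTurn-≤-suc-catTurn {A = A} f v with isolated-or-neighbour A v
  ... | inj₁ isolated-v = ≤-trans (≤-reflexive (herderTurn-isolated (suc f) isolated-v)) z≤n
  ... | inj₂ (u , Avu)  =
    ≤-trans (herderTurn-≤-cut f Avu) (s≤s (catTurn-mono f (deleteAdj-⊆ᴱ v u) v))

  -- Adjacency need not be symmetric, so the copied cut may be xy or yx.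
  ⊆ᴱ⇒herderTurn-≤-cut : ∀ f → B ⊆ᴱ A → ∀ x y v →
                       herderTurn (suc f) B v ≤ suc (catTurn f (deleteAdj A x y) v)
  ⊆ᴱ⇒herderTurn-≤-cut {B = B} f B⊆A x y v with T? (B x y) | T? (B y x)
  ... | yes Bxy | _ =
    ≤-trans (herderTurn-≤-cut f Bxy) (s≤s (catTurn-mono f (deleteAdj-mono x y B⊆A) v))
  ... | no _ | yes Byx =
    ≤-trans (herderTurn-≤-cut f Byx)
            (s≤s (catTurn-mono f (⊆ᴱ-trans (deleteAdj-mono y x B⊆A) (deleteAdj-swap y x)) v))
  ... | no ¬Bxy | no ¬Byx =
    ≤-trans (herderTurn-≤-suc-catTurn f v)
            (s≤s (catTurn-mono f (⊆ᴱ-deleteAdj x y B⊆A ¬Bxy ¬Byx) v))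

  herderTurn-mono zero B⊆A v = z≤n
  herderTurn-mono {B = B} {A = A} (suc f) B⊆A v with isolated-or-neighbour B v
  ... | inj₁ isolated-v = ≤-trans (≤-reflexive (herderTurn-isolated (suc f) isolated-v)) z≤n
  ... | inj₂ (_ , Bvu) rewrite neighbour⇒¬isolated {A = A} (B⊆A .edge Bvu) =
    ≤-minList (∈-map⁺ _ (∈-edgesOf⁺ (B⊆A .edge Bvu)))
              (map⁺ (tabulate λ {(x , y)} _ → ⊆ᴱ⇒herderTurn-≤-cut f B⊆A x y v))

  catTurn-mono {B = B} {A = A} f B⊆A v with isolated-or-neighbour B v
  ... | inj₁ isolated-v rewrite isolated-v = z≤n
  ... | inj₂ (_ , Bvu) rewrite neighbour⇒¬isolated {A = B} Bvu
                             | neighbour⇒¬isolated {A = A} (B⊆A .edge Bvu) =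
    maxList-≤ (map⁺ (tabulate λ {w} w∈ →
      ≤-trans (herderTurn-mono f B⊆A w) (≤-maxList (∈-map⁺ _ (catTargets-mono B⊆A v w∈)))))

mainTheorem13 : {n : ℕ} (G : SimpleGraph n) → Connected G →
                (v a b : Fin n) → adj G a b ≡ true →
                cat G v ≥ cat (deleteEdge G a b) v
mainTheorem13 {n} G _ v a b _ = herderTurn-mono (n * n) (deleteAdj-⊆ᴱ a b) v
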